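{- Let $k$ be a positive integer and let $G$ be a graph that is not $(k+1)$-connected and has minimum degree at least $\frac{3k-1}{2}$. Then: (1) If $(S,K)\in P_0(G)$ and $(S',K')\in P(G)$ are distinct, then $K\subseteq K'$ or $(K\cup S)\cap(K'\cup S')=S\cap S'$. (2) If $(S,K),(S',K')\in P_0(G)$ are distinct, then $(K\cup S)\cap(K'\cup S')=S\cap S'$. (3) A pair $(S,K)\in P(G)$ belongs to $P_0(G)$ if and only if there is no separator $S'$ of $G$ of minimum cardinality with $S'\cap K\neq\emptyset$.
   Context: Graphs are finite, simple and undirected. A graph is $k$-connected if it has more than $k$ vertices and $G-X$ is connected for every $X\subseteq V(G)$ with $|X|<k$. A separator of $G$ is a set $S\subseteq V(G)$ with $G-S$ disconnected. $P(G)$ is the set of pairs $(S,K)$ where $S$ is a separator of $G$ of minimum cardinality and $K\subseteq V(G)\setminus S$ is the vertex set of a connected component of $G-S$. $P(G)$ is partially ordered by $(S,K)\le(S',K')$ iff $K\subseteq K'$, and $P_0(G)$ is the set of minimal elements of $P(G)$. -}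

module Defs where

open import Data.Nat using (ℕ; _≤_; _<_; _*_; _+_)
open import Data.Bool using (Bool; true; false)
open import Data.Fin using (Fin)
open import Data.Fin.Subset using (Subset; _∈_; _∉_; _⊆_; ∁; ∣_∣; Nonempty)
open import Data.Vec using (tabulate)
open import Data.Product using (_×_; Σ; ∃)
open import Relation.Binary.PropositionalEquality using (_≡_)
open import Relation.Nullary using (¬_)

record Graph (n : ℕ) : Set where
  field
    adj     : Fin n → Fin n → Bool
    sym     : ∀ u v → adj u v ≡ adj v u
    irrefl  : ∀ v → adj v v ≡ false
open Graph public

module _ {n : ℕ} (G : Graph n) where

  degree : Fin n → ℕ
  degree v = ∣ tabulate (adj G v) ∣

  data Reach (A : Subset n) : Fin n → Fin n → Set where
    here : ∀ {u} → u ∈ A → Reach A u u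
    step : ∀ {u w v} → u ∈ A → adj G u w ≡ true → Reach A w v → Reach A u v

  Connected : Subset n → Set
  Connected A = ∀ u v → u ∈ A → v ∈ A → Reach A u v

  IsConnectedK : ℕ → Set
  IsConnectedK k = k < n × (∀ (X : Subset n) → ∣ X ∣ < k → Connected (∁ X))

  Separator : Subset n → Set
  Separator S = ¬ Connected (∁ S)

  MinSeparator : Subset n → Set
  MinSeparator S = Separator S × (∀ S' → Separator S' → ∣ S ∣ ≤ ∣ S' ∣)

  Component : Subset n → Subset n → Set
  Component S K =
    Nonempty K ×
    (∀ u → u ∈ K → ∀ v → (v ∈ K → v ∉ S × Reach (∁ S) u v)
                        × (v ∉ S → Reach (∁ S) u v → v ∈ K))

  InP : Subset n → Subset n → Set
  InP S K = MinSeparator S × Component S K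

  -- membership in P₀(G): minimal elements of P(G) under the order
  -- (S',K') ≤ (S,K) iff K' ⊆ K; minimal: every (S',K') ≤ (S,K) in P(G) equals (S,K)
  InP₀ : Subset n → Subset n → Set
  InP₀ S K = InP S K ×
    (∀ S' K' → InP S' K' → K' ⊆ K → S' ≡ S × K' ≡ K)

-- Let κ be the connectivity of G.  Since G is not (k+1)-connected, κ ≤ k, and the
-- degree condition 3k ≤ 2δ + 1 says that any "shore" X of a separator Z of size
-- at most k (a vertex set avoiding Z whose outgoing edges all end in Z) is big:
-- |Z| < 2|X|, because a vertex of X has all its neighbours in X ∪ Z.
--
-- The heart of the proof is a crossing argument: if (S,K) ∈ P₀(G) and T is any
-- minimum separator, then T does not meet K.  Otherwise take a component L of
-- G - T and let K̄, L̄ be the rest of G - S, G - T.  Each nonempty corner X ∩ Y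
-- (X ∈ {K,K̄}, Y ∈ {L,L̄}) is a shore of a "corner separator", whose size must
-- be at least κ — strictly more than κ for the corners inside K, by minimality of
-- K, since they miss the vertex t ∈ K ∩ T.  Each empty pair of corners forces a
-- side into the other separator, which the degree bound makes heavy.  Adding up
-- these inequalities is contradictory in every case (`crossing-arithmetic`).

module Submission where

open import Defs
open import Data.Nat using (ℕ; zero; suc; _≤_; _<_; _*_; _+_; z≤n; s≤s; _≤?_)
open import Data.Nat.Properties
open import Data.Nat.Tactic.RingSolver using (solve)
open import Data.List using ([]; _∷_)
open import Data.Bool using (true)
open import Data.Bool.Properties using () renaming (_≟_ to _≟ᴮ_)
open import Data.Fin using (Fin) renaming (_≟_ to _≟ᶠ_)
open import Data.Fin.Properties using (any?)
open import Data.Fin.Subset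
  using (Subset; inside; outside; _⊆_; _⊂_; _∩_; _∪_; Nonempty; _∈_; _∉_; ∁; ∣_∣; ⁅_⁆; _-_; ⊤)
open import Data.Fin.Subset.Properties
  using ( _∈?_; x∈p∩q⁻; x∈p∩q⁺; x∈p∪q⁻; x∈p∪q⁺; x∈∁p⇒x∉p; x∉p⇒x∈∁p
        ; ⊆-antisym; p⊆q⇒∣p∣≤∣q∣; p⊂q⇒∣p∣<∣q∣; ∣p∣≤n; ∩-comm; ⊆⊤; ∈⊤; ∣⊤∣≡n
        ; x∈⁅x⁆; x∈⁅y⁆⇒x≡y; ∣⁅x⁆∣≡1; x∈p⇒∣p-x∣<∣p∣; x∈p∧x≢y⇒x∈p-y; p─q⊆p)
import Data.Vec as Vec
open import Data.Vec using (tabulate)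
open import Data.Vec.Properties using (lookup∘tabulate; []=⇒lookup; lookup⇒[]=)
open import Data.Product using (_×_; ∃; _,_; proj₁; proj₂)
open import Data.Sum using (_⊎_; inj₁; inj₂; [_,_])
open import Data.Empty using (⊥; ⊥-elim)
open import Relation.Binary.PropositionalEquality
  using (_≡_; refl; cong; trans; subst) renaming (sym to ≡-sym)
open import Relation.Nullary using (¬_; Dec; yes; no; does)
open import Relation.Nullary.Decidable using (_×-dec_; dec-true)
open import Function using (_∘_)
open import Function.Bundles using (_⇔_; mk⇔)

Disjoint : ∀ {n} → Subset n → Subset n → Set
Disjoint p q = ∀ {a} → a ∈ p → a ∉ q

disjoint-sym : ∀ {n} {p q : Subset n} → Disjoint p q → Disjoint q p
disjoint-sym d aq ap = d ap aq

disjoint? : ∀ {n} (p q : Subset n) → Disjoint p q ⊎ ∃ λ a → a ∈ p × a ∈ q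
disjoint? p q with any? (λ a → (a ∈? p) ×-dec (a ∈? q))
... | yes common = inj₂ common
... | no none    = inj₁ (λ ap aq → none (_ , ap , aq))

does⇒ : ∀ {P : Set} (d : Dec P) → does d ≡ true → P
does⇒ (yes p) _ = p
does⇒ (no _) ()

covered : ∀ {n} {X Y Z : Subset n} → Disjoint X Y → Disjoint X (∁ (Y ∪ Z)) → X ⊆ Z
covered {Z = Z} dY dRest {a} aX with a ∈? Z
... | yes aZ = aZ
... | no  aZ = ⊥-elim (dRest aX (x∉p⇒x∈∁p λ aYZ → [ dY aX , aZ ] (x∈p∪q⁻ _ Z aYZ)))

∣∪∣≡+ : ∀ {n} (p q : Subset n) → Disjoint p q → ∣ p ∪ q ∣ ≡ ∣ p ∣ + ∣ q ∣
∣∪∣≡+ Vec.[] Vec.[] d = refl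
∣∪∣≡+ (inside Vec.∷ p) (inside Vec.∷ q) d = ⊥-elim (d Vec.here Vec.here)
∣∪∣≡+ (inside Vec.∷ p) (outside Vec.∷ q) d =
  cong suc (∣∪∣≡+ p q λ a b → d (Vec.there a) (Vec.there b))
∣∪∣≡+ (outside Vec.∷ p) (inside Vec.∷ q) d =
  trans (cong suc (∣∪∣≡+ p q λ a b → d (Vec.there a) (Vec.there b))) (≡-sym (+-suc ∣ p ∣ ∣ q ∣))
∣∪∣≡+ (outside Vec.∷ p) (outside Vec.∷ q) d = ∣∪∣≡+ p q λ a b → d (Vec.there a) (Vec.there b)

∣∪∣≤+ : ∀ {n} (p q : Subset n) → ∣ p ∪ q ∣ ≤ ∣ p ∣ + ∣ q ∣
∣∪∣≤+ Vec.[] Vec.[] = z≤n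
∣∪∣≤+ (inside Vec.∷ p) (inside Vec.∷ q) = s≤s (≤-trans (∣∪∣≤+ p q) (+-monoʳ-≤ ∣ p ∣ (n≤1+n _)))
∣∪∣≤+ (inside Vec.∷ p) (outside Vec.∷ q) = s≤s (∣∪∣≤+ p q)
∣∪∣≤+ (outside Vec.∷ p) (inside Vec.∷ q) = ≤-trans (s≤s (∣∪∣≤+ p q)) (≤-reflexive (≡-sym (+-suc ∣ p ∣ ∣ q ∣)))
∣∪∣≤+ (outside Vec.∷ p) (outside Vec.∷ q) = ∣∪∣≤+ p q

⊆-∣≥∣⇒≡ : ∀ {n} {p q : Subset n} → p ⊆ q → ∣ q ∣ ≤ ∣ p ∣ → p ≡ q
⊆-∣≥∣⇒≡ {p = p} {q} p⊆q q-small = ⊆-antisym p⊆q q⊆p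
  where
  q⊆p : q ⊆ p
  q⊆p {a} a∈q with a ∈? p
  ... | yes a∈p = a∈p
  ... | no  a∉p = ⊥-elim (<⇒≱ (p⊂q⇒∣p∣<∣q∣ (p⊆q , a , a∈q , a∉p)) q-small)

disjoint₃-size : ∀ {n} {A B C D : Subset n} → Disjoint A B → Disjoint A C → Disjoint B C
  → A ⊆ D → B ⊆ D → C ⊆ D → ∣ A ∣ + ∣ B ∣ + ∣ C ∣ ≤ ∣ D ∣
disjoint₃-size {A = A} {B} {C} {D} AB AC BC A⊆D B⊆D C⊆D = begin
    ∣ A ∣ + ∣ B ∣ + ∣ C ∣ ≡⟨ cong (_+ ∣ C ∣) (≡-sym (∣∪∣≡+ A B AB)) ⟩
    ∣ A ∪ B ∣ + ∣ C ∣     ≡⟨ ≡-sym (∣∪∣≡+ (A ∪ B) C AB-C) ⟩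
    ∣ (A ∪ B) ∪ C ∣       ≤⟨ p⊆q⇒∣p∣≤∣q∣ ABC⊆D ⟩
    ∣ D ∣                 ∎
  where
  open ≤-Reasoning
  AB-C : Disjoint (A ∪ B) C
  AB-C m = [ AC , BC ] (x∈p∪q⁻ A B m)
  ABC⊆D : (A ∪ B) ∪ C ⊆ D
  ABC⊆D m = [ [ A⊆D , B⊆D ] ∘ x∈p∪q⁻ A B , C⊆D ] (x∈p∪q⁻ (A ∪ B) C m)

-- A vertex of degree d with 3k ≤ 2d + 1 whose closed neighbourhood (d + 1
-- vertices) lies in X ∪ Z, where κ = |Z| ≤ k, forces κ < 2|X|.
degree-arithmetic : ∀ κ k d x → κ ≤ k → 3 * k ≤ 2 * d + 1 → d + 1 ≤ x + κ → κ < 2 * x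
degree-arithmetic κ k d x κ≤k deg nbhd = +-cancelˡ-≤ (2 * κ) (suc κ) (2 * x) (begin
    2 * κ + suc κ   ≡⟨ solve (κ ∷ []) ⟩
    suc (3 * κ)     ≤⟨ s≤s (*-monoʳ-≤ 3 κ≤k) ⟩
    suc (3 * k)     ≤⟨ s≤s deg ⟩
    suc (2 * d + 1) ≡⟨ solve (d ∷ []) ⟩
    2 * (d + 1)     ≤⟨ *-monoʳ-≤ 2 nbhd ⟩
    2 * (x + κ)     ≡⟨ solve (x ∷ κ ∷ []) ⟩
    2 * κ + 2 * x   ∎)
  where open ≤-Reasoning

sum-contradiction : ∀ {a b b'} (e : ℕ) → a < b → b' ≤ a → b + e ≡ b' → ⊥
sum-contradiction {b = b} e a<b b'≤a eq = <⇒≱ (<-≤-trans a<b (subst (b ≤_) eq (m≤m+n b e))) b'≤a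

infixl 6 _<+<_ _<+≤_ _≤+≤_
_<+<_ : ∀ {a b c d} → a < b → c < d → a + c < b + d
h <+< h' = +-mono-<-≤ h (<⇒≤ h')
_<+≤_ : ∀ {a b c d} → a < b → c ≤ d → a + c < b + d
_<+≤_ = +-mono-<-≤
_≤+≤_ : ∀ {a b c d} → a ≤ b → c ≤ d → a + c ≤ b + d
_≤+≤_ = +-mono-≤

-- Two minimum separators of size
-- κ meet in c vertices; the rest of each is split p/q resp. r/s between the two
-- sides of the other.  Each corner is either empty (E₁ … E₄) or gives a lower
-- bound on κ, and each pair of empty corners along a side makes that side's
-- share exceed κ/2.  In every case some sum of these inequalities fails.
crossing-arithmetic : ∀ {E₁ E₂ E₃ E₄ : Set} (κ p q r s c : ℕ)
  → r + c + s ≤ κ → p + c + q ≤ κ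
  → (E₁ ⊎ κ < r + c + p) → (E₂ ⊎ κ < s + c + p)
  → (E₃ ⊎ κ ≤ r + c + q) → (E₄ ⊎ κ ≤ s + c + q)
  → (E₁ → E₂ → κ < 2 * p) → (E₃ → E₄ → κ < 2 * q)
  → (E₁ → E₃ → κ < 2 * r) → (E₂ → E₄ → κ < 2 * s)
  → ⊥
crossing-arithmetic κ p q r s c hS hT (inj₂ b₁) _ _ (inj₂ b₄) _ _ _ _ =
  sum-contradiction 0 (b₁ <+≤ b₄) (hS ≤+≤ hT) (solve (r ∷ c ∷ p ∷ s ∷ q ∷ []))
crossing-arithmetic κ p q r s c hS hT _ (inj₂ b₂) (inj₂ b₃) _ _ _ _ _ =
  sum-contradiction 0 (b₂ <+≤ b₃) (hS ≤+≤ hT) (solve (r ∷ c ∷ p ∷ s ∷ q ∷ []))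
crossing-arithmetic κ p q r s c hS hT (inj₁ e₁) (inj₁ e₂) (inj₁ e₃) (inj₁ e₄) P Q R S =
  sum-contradiction (c + c) (P e₁ e₂ <+< Q e₃ e₄) (hT ≤+≤ hT) (solve (r ∷ c ∷ p ∷ s ∷ q ∷ []))
crossing-arithmetic κ p q r s c hS hT (inj₂ b₁) (inj₁ e₂) (inj₁ e₃) (inj₁ e₄) P Q R S =
  sum-contradiction (c + c) (b₁ <+< b₁ <+< S e₂ e₄ <+< Q e₃ e₄) (hS ≤+≤ hS ≤+≤ hT ≤+≤ hT)
    (solve (r ∷ c ∷ p ∷ s ∷ q ∷ []))
crossing-arithmetic κ p q r s c hS hT (inj₁ e₁) (inj₂ b₂) (inj₁ e₃) (inj₁ e₄) P Q R S =
  sum-contradiction (c + c) (b₂ <+< b₂ <+< R e₁ e₃ <+< Q e₃ e₄) (hS ≤+≤ hS ≤+≤ hT ≤+≤ hT)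
    (solve (r ∷ c ∷ p ∷ s ∷ q ∷ []))
crossing-arithmetic κ p q r s c hS hT (inj₁ e₁) (inj₁ e₂) (inj₂ b₃) (inj₁ e₄) P Q R S =
  sum-contradiction (c + c) (P e₁ e₂ <+< S e₂ e₄ <+≤ b₃ <+≤ b₃) (hS ≤+≤ hS ≤+≤ hT ≤+≤ hT)
    (solve (r ∷ c ∷ p ∷ s ∷ q ∷ []))
crossing-arithmetic κ p q r s c hS hT (inj₁ e₁) (inj₁ e₂) (inj₁ e₃) (inj₂ b₄) P Q R S =
  sum-contradiction (c + c) (P e₁ e₂ <+< R e₁ e₃ <+≤ b₄ <+≤ b₄) (hS ≤+≤ hS ≤+≤ hT ≤+≤ hT)
    (solve (r ∷ c ∷ p ∷ s ∷ q ∷ []))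
crossing-arithmetic κ p q r s c hS hT (inj₂ b₁) (inj₂ b₂) (inj₁ e₃) (inj₁ e₄) P Q R S =
  sum-contradiction c (b₁ <+< b₂ <+< Q e₃ e₄) (hS ≤+≤ hT ≤+≤ hT) (solve (r ∷ c ∷ p ∷ s ∷ q ∷ []))
crossing-arithmetic κ p q r s c hS hT (inj₂ b₁) (inj₁ e₂) (inj₂ b₃) (inj₁ e₄) P Q R S =
  sum-contradiction c (b₁ <+< S e₂ e₄ <+≤ b₃) (hS ≤+≤ hS ≤+≤ hT) (solve (r ∷ c ∷ p ∷ s ∷ q ∷ []))
crossing-arithmetic κ p q r s c hS hT (inj₁ e₁) (inj₂ b₂) (inj₁ e₃) (inj₂ b₄) P Q R S =
  sum-contradiction c (b₂ <+< R e₁ e₃ <+≤ b₄) (hS ≤+≤ hS ≤+≤ hT) (solve (r ∷ c ∷ p ∷ s ∷ q ∷ []))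
crossing-arithmetic κ p q r s c hS hT (inj₁ e₁) (inj₁ e₂) (inj₂ b₃) (inj₂ b₄) P Q R S =
  sum-contradiction c (P e₁ e₂ <+≤ b₃ <+≤ b₄) (hS ≤+≤ hT ≤+≤ hT) (solve (r ∷ c ∷ p ∷ s ∷ q ∷ []))

module _ {n : ℕ} (G : Graph n) where

  Edge : Fin n → Fin n → Set
  Edge u w = adj G u w ≡ true

  edge-sym : ∀ {u w} → Edge u w → Edge w u
  edge-sym {u} {w} e = trans (sym G w u) e

  reach-start : ∀ {A u v} → Reach G A u v → u ∈ A
  reach-start (here a)     = a
  reach-start (step a _ _) = a

  reach-end : ∀ {A u v} → Reach G A u v → v ∈ A
  reach-end (here a)     = a
  reach-end (step _ _ r) = reach-end r

  reach-trans : ∀ {A u v w} → Reach G A u v → Reach G A v w → Reach G A u w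
  reach-trans (here _)     r' = r'
  reach-trans (step a e r) r' = step a e (reach-trans r r')

  reach-snoc : ∀ {A u v w} → Reach G A u v → Edge v w → w ∈ A → Reach G A u w
  reach-snoc r e w∈A = reach-trans r (step (reach-end r) e (here w∈A))

  reach-sym : ∀ {A u v} → Reach G A u v → Reach G A v u
  reach-sym (here a)     = here a
  reach-sym (step a e r) = reach-snoc (reach-sym r) (edge-sym e) a

  reach-mono : ∀ {A B u v} → A ⊆ B → Reach G A u v → Reach G B u v
  reach-mono A⊆B (here a)     = here (A⊆B a)
  reach-mono A⊆B (step a e r) = step (A⊆B a) e (reach-mono A⊆B r)

  neighbours : Subset n → Subset n
  neighbours R = tabulate (λ w → does (any? (λ i → (i ∈? R) ×-dec (adj G i w ≟ᴮ true))))

  neighbours⁻ : ∀ {R w} → w ∈ neighbours R → ∃ λ i → i ∈ R × Edge i w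
  neighbours⁻ {R} {w} h =
    does⇒ (any? _) (trans (≡-sym (lookup∘tabulate _ w)) ([]=⇒lookup h))

  neighbours⁺ : ∀ {R i w} → i ∈ R → Edge i w → w ∈ neighbours R
  neighbours⁺ {R} {i} {w} i∈R e =
    lookup⇒[]= w (neighbours R) (trans (lookup∘tabulate _ w) (dec-true (any? _) (i , i∈R , e)))

  -- Layer m + 1 adds to layer m its
  -- neighbours in A; the layers grow strictly until they are closed under
  -- A-edges, so layer n + 1 is exactly the set of vertices reachable from x.
  module Search (A : Subset n) (x : Fin n) where

    layer : ℕ → Subset n
    layer zero    = ⁅ x ⁆
    layer (suc m) = layer m ∪ (A ∩ neighbours (layer m))

    Saturated : ℕ → Set
    Saturated m = ∀ {i w} → i ∈ layer m → w ∈ A → Edge i w → w ∈ layer m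

    layer-grows : ∀ m → layer m ⊆ layer (suc m)
    layer-grows m h = x∈p∪q⁺ (inj₁ h)

    saturated-stable : ∀ m → Saturated m → layer (suc m) ⊆ layer m
    saturated-stable m sat h with x∈p∪q⁻ _ _ h
    ... | inj₁ old = old
    ... | inj₂ new with x∈p∩q⁻ _ _ new
    ... | w∈A , w∈N with neighbours⁻ w∈N
    ... | i , i∈layer , e = sat i∈layer w∈A e

    saturated-suc : ∀ m → Saturated m → Saturated (suc m)
    saturated-suc m sat i w∈A e = layer-grows m (sat (saturated-stable m sat i) w∈A e)

    no-growth⇒saturated : ∀ m → ∣ layer (suc m) ∣ ≤ ∣ layer m ∣ → Saturated m
    no-growth⇒saturated m small {i} {w} i∈layer w∈A e with w ∈? layer m
    ... | yes w∈layer = w∈layer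
    ... | no  w∉layer = ⊥-elim (<⇒≱ (p⊂q⇒∣p∣<∣q∣ grows) small)
      where
      grows : layer m ⊂ layer (suc m)
      grows = layer-grows m , w , x∈p∪q⁺ (inj₂ (x∈p∩q⁺ (w∈A , neighbours⁺ i∈layer e))) , w∉layer

    saturated-or-large : ∀ m → Saturated m ⊎ m ≤ ∣ layer m ∣
    saturated-or-large zero = inj₂ z≤n
    saturated-or-large (suc m) with saturated-or-large m
    ... | inj₁ sat = inj₁ (saturated-suc m sat)
    ... | inj₂ large with ∣ layer (suc m) ∣ ≤? ∣ layer m ∣
    ... | yes small = inj₁ (saturated-suc m (no-growth⇒saturated m small))
    ... | no  grows = inj₂ (≤-trans (s≤s large) (≰⇒> grows))

    reachable : Subset n
    reachable = layer (suc n)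

    reachable-saturated : Saturated (suc n)
    reachable-saturated with saturated-or-large (suc n)
    ... | inj₁ sat   = sat
    ... | inj₂ large = ⊥-elim (<⇒≱ large (∣p∣≤n reachable))

    start-reachable : x ∈ reachable
    start-reachable = start-in (suc n)
      where
      start-in : ∀ m → x ∈ layer m
      start-in zero    = x∈⁅x⁆ x
      start-in (suc m) = layer-grows m (start-in m)

    layer⇒reach : x ∈ A → ∀ m {w} → w ∈ layer m → Reach G A x w
    layer⇒reach x∈A zero h with x∈⁅y⁆⇒x≡y x h
    ... | refl = here x∈A
    layer⇒reach x∈A (suc m) h with x∈p∪q⁻ _ _ h
    ... | inj₁ old = layer⇒reach x∈A m old
    ... | inj₂ new with x∈p∩q⁻ _ _ new
    ... | w∈A , w∈N with neighbours⁻ w∈N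
    ... | i , i∈layer , e = reach-snoc (layer⇒reach x∈A m i∈layer) e w∈A

    reachable⇒reach : x ∈ A → ∀ {w} → w ∈ reachable → Reach G A x w
    reachable⇒reach x∈A = layer⇒reach x∈A (suc n)

    reach-closed : ∀ {u v} → Reach G A u v → u ∈ reachable → v ∈ reachable
    reach-closed (here _)     h = h
    reach-closed (step a e r) h = reach-closed r (reachable-saturated h (reach-start r) e)

  reach? : ∀ A u v → Dec (Reach G A u v)
  reach? A u v with u ∈? A
  ... | no  u∉A = no (λ r → u∉A (reach-start r))
  ... | yes u∈A with v ∈? Search.reachable A u
  ... | yes v∈R = yes (Search.reachable⇒reach A u u∈A v∈R)
  ... | no  v∉R = no (λ r → v∉R (Search.reach-closed A u r (Search.start-reachable A u)))

  separator-misses : ∀ {Z} → Separator G Z → ∃ λ y → y ∉ Z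
  separator-misses {Z} separates with any? (_∈? ∁ Z)
  ... | yes (y , y∈∁Z) = y , x∈∁p⇒x∉p y∈∁Z
  ... | no  none       = ⊥-elim (separates λ u _ u∈∁Z _ → ⊥-elim (none (u , u∈∁Z)))

  component : Subset n → Fin n → Subset n
  component Z x = Search.reachable (∁ Z) x

  component-∋ : ∀ Z x → x ∈ component Z x
  component-∋ Z x = Search.start-reachable (∁ Z) x

  component-is : ∀ {Z x} → x ∉ Z → Component G Z (component Z x)
  component-is {Z} {x} x∉Z = (x , component-∋ Z x) , λ u u∈C v →
      (λ v∈C → x∈∁p⇒x∉p (reach-end (path v∈C)) , reach-trans (reach-sym (path u∈C)) (path v∈C))
    , λ _ r → Search.reach-closed (∁ Z) x (reach-trans (path u∈C) r) (component-∋ Z x)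
    where
    path : ∀ {w} → w ∈ component Z x → Reach G (∁ Z) x w
    path = Search.reachable⇒reach (∁ Z) x (x∉p⇒x∈∁p x∉Z)

  record Shore (Z X : Subset n) : Set where
    field
      avoids : ∀ {a} → a ∈ X → a ∉ Z
      exits  : ∀ {a w} → a ∈ X → Edge a w → w ∈ X ⊎ w ∈ Z
  open Shore

  shore-confines : ∀ {Z X u v} → Shore Z X → u ∈ X → Reach G (∁ Z) u v → Reach G X u v
  shore-confines sh u∈X (here _) = here u∈X
  shore-confines sh u∈X (step _ e r) with exits sh u∈X e
  ... | inj₁ w∈X = step u∈X e (shore-confines sh w∈X r)
  ... | inj₂ w∈Z = ⊥-elim (x∈∁p⇒x∉p (reach-start r) w∈Z)

  shore-separates : ∀ {Z X x y} → Shore Z X → x ∈ X → y ∉ X → y ∉ Z → Separator G Z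
  shore-separates sh x∈X y∉X y∉Z connected =
    y∉X (reach-end (shore-confines sh x∈X (connected _ _ (x∉p⇒x∈∁p (avoids sh x∈X)) (x∉p⇒x∈∁p y∉Z))))

  component-⊆-shore : ∀ {Z X x} → Shore Z X → x ∈ X → component Z x ⊆ X
  component-⊆-shore {Z} {X} {x} sh x∈X m =
    reach-end (shore-confines sh x∈X (Search.reachable⇒reach (∁ Z) x (x∉p⇒x∈∁p (avoids sh x∈X)) m))

  degree-bound : ∀ {Z X v} → Shore Z X → v ∈ X → degree G v + 1 ≤ ∣ X ∣ + ∣ Z ∣
  degree-bound {Z} {X} {v} sh v∈X = begin
     degree G v + 1        ≡⟨ cong (degree G v +_) (≡-sym (∣⁅x⁆∣≡1 v)) ⟩
     ∣ N ∣ + ∣ ⁅ v ⁆ ∣     ≡⟨ ≡-sym (∣∪∣≡+ N ⁅ v ⁆ loopless) ⟩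
     ∣ N ∪ ⁅ v ⁆ ∣         ≤⟨ p⊆q⇒∣p∣≤∣q∣ closed-nbhd⊆ ⟩
     ∣ X ∪ Z ∣             ≤⟨ ∣∪∣≤+ X Z ⟩
     ∣ X ∣ + ∣ Z ∣         ∎
    where
    open ≤-Reasoning
    N : Subset n
    N = tabulate (adj G v)
    N⁻ : ∀ {i} → i ∈ N → Edge v i
    N⁻ {i} h = trans (≡-sym (lookup∘tabulate (adj G v) i)) ([]=⇒lookup h)
    loopless : Disjoint N ⁅ v ⁆
    loopless h h' with x∈⁅y⁆⇒x≡y v h'
    ... | refl with trans (≡-sym (N⁻ h)) (irrefl G v)
    ... | ()
    closed-nbhd⊆ : N ∪ ⁅ v ⁆ ⊆ X ∪ Z
    closed-nbhd⊆ m with x∈p∪q⁻ N ⁅ v ⁆ m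
    ... | inj₁ h = x∈p∪q⁺ (exits sh v∈X (N⁻ h))
    ... | inj₂ h with x∈⁅y⁆⇒x≡y v h
    ... | refl = x∈p∪q⁺ (inj₁ v∈X)

  module ComponentFacts {S K : Subset n} (c : Component G S K) where

    avoids-S : ∀ {a} → a ∈ K → a ∉ S
    avoids-S a∈K = proj₁ (proj₁ (proj₂ c _ a∈K _) a∈K)

    closed : ∀ {a w} → a ∈ K → Edge a w → w ∉ S → w ∈ K
    closed a∈K e w∉S =
      proj₂ (proj₂ c _ a∈K _) w∉S (step (x∉p⇒x∈∁p (avoids-S a∈K)) e (here (x∉p⇒x∈∁p w∉S)))

    connected : ∀ {u v} → u ∈ K → v ∈ K → Reach G (∁ S) u v
    connected u∈K v∈K = proj₂ (proj₁ (proj₂ c _ u∈K _) v∈K)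

    shore : Shore S K
    avoids shore = avoids-S
    exits  shore {w = w} a∈K e with w ∈? S
    ... | yes w∈S = inj₂ w∈S
    ... | no  w∉S = inj₁ (closed a∈K e w∉S)

    remainder : Subset n
    remainder = ∁ (K ∪ S)

    remainder⁻ : ∀ {y} → y ∈ remainder → y ∉ K × y ∉ S
    remainder⁻ h = (λ y∈K → x∈∁p⇒x∉p h (x∈p∪q⁺ (inj₁ y∈K))) , (λ y∈S → x∈∁p⇒x∉p h (x∈p∪q⁺ (inj₂ y∈S)))

    remainder⁺ : ∀ {y} → y ∉ K → y ∉ S → y ∈ remainder
    remainder⁺ y∉K y∉S = x∉p⇒x∈∁p (λ m → [ y∉K , y∉S ] (x∈p∪q⁻ K S m))

    remainder-shore : Shore S remainder
    avoids remainder-shore a∈O = proj₂ (remainder⁻ a∈O)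
    exits  remainder-shore {a} {w} a∈O e with w ∈? S | w ∈? K
    ... | yes w∈S | _       = inj₂ w∈S
    ... | no  w∉S | yes w∈K = ⊥-elim (proj₁ (remainder⁻ a∈O) (closed w∈K (edge-sym e) (proj₂ (remainder⁻ a∈O))))
    ... | no  w∉S | no  w∉K = inj₁ (remainder⁺ w∉K w∉S)

    remainder-nonempty : Separator G S → ∃ λ y → y ∈ remainder
    remainder-nonempty separates with any? (_∈? remainder)
    ... | yes found = found
    ... | no  none  = ⊥-elim (separates λ u v u∉S v∉S → connected (in-K u∉S) (in-K v∉S))
      where
      in-K : ∀ {u} → u ∈ ∁ S → u ∈ K
      in-K {u} u∉S with u ∈? K
      ... | yes u∈K = u∈K
      ... | no  u∉K = ⊥-elim (none (u , remainder⁺ u∉K (x∈∁p⇒x∉p u∉S)))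

    -- Every vertex of a minimum separator has a neighbour in each component:
    -- otherwise S - s would still separate K from the remainder.
    neighbour-in : MinSeparator G S → ∀ {s} → s ∈ S → ∃ λ w → w ∈ K × Edge s w
    neighbour-in (separates , minimum) {s} s∈S
      with any? (λ w → (w ∈? K) ×-dec (adj G s w ≟ᴮ true))
    ... | yes found = found
    ... | no  none  = ⊥-elim (<⇒≱ (x∈p⇒∣p-x∣<∣p∣ s∈S) (minimum (S - s) smaller-separates))
      where
      S-s⊆S : S - s ⊆ S
      S-s⊆S = p─q⊆p S ⁅ s ⁆
      smaller-shore : Shore (S - s) K
      avoids smaller-shore a∈K m = avoids-S a∈K (S-s⊆S m)
      exits  smaller-shore {a} {w} a∈K e with exits shore a∈K e
      ... | inj₁ w∈K = inj₁ w∈K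
      ... | inj₂ w∈S with w ≟ᶠ s
      ... | yes refl = ⊥-elim (none (a , a∈K , edge-sym e))
      ... | no  w≢s  = inj₂ (x∈p∧x≢y⇒x∈p-y w∈S w≢s)
      smaller-separates : Separator G (S - s)
      smaller-separates with remainder-nonempty separates
      ... | _ , y∈R = shore-separates smaller-shore (proj₂ (proj₁ c))
                        (proj₁ (remainder⁻ y∈R)) (λ m → proj₂ (remainder⁻ y∈R) (S-s⊆S m))

    three-parts : ∀ W → ∣ K ∩ W ∣ + ∣ S ∩ W ∣ + ∣ remainder ∩ W ∣ ≤ ∣ W ∣
    three-parts W = disjoint₃-size
      (λ a b → avoids-S (left a) (left b))
      (λ a b → proj₁ (remainder⁻ (left b)) (left a))
      (λ a b → proj₂ (remainder⁻ (left b)) (left a))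
      right right right
      where
      left : ∀ {X a} → a ∈ X ∩ W → a ∈ X
      left {X} m = proj₁ (x∈p∩q⁻ X W m)
      right : ∀ {X a} → a ∈ X ∩ W → a ∈ W
      right {X} m = proj₂ (x∈p∩q⁻ X W m)

  component-⊆ : ∀ {S K S' K' x} → Component G S K → Component G S' K'
    → Disjoint K S' → x ∈ K → x ∈ K' → K ⊆ K'
  component-⊆ cK cK' K∩S'=∅ x∈K x∈K' {v} v∈K =
    proj₂ (proj₂ cK' _ x∈K' v) (K∩S'=∅ v∈K)
      (reach-mono (λ m → x∉p⇒x∈∁p (K∩S'=∅ m)) (shore-confines shore x∈K (connected x∈K v∈K)))
    where open ComponentFacts cK

  -- For shores X of S and Y of T, the corner X ∩ Y is a shore of this set.
  corner : (S T X Y : Subset n) → Subset n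
  corner S T X Y = ((Y ∩ S) ∪ (S ∩ T)) ∪ (X ∩ T)

  corner-shore : ∀ {S T X Y} → Shore S X → Shore T Y → Shore (corner S T X Y) (X ∩ Y)
  avoids (corner-shore {S} {T} {X} {Y} sX sY) m z with x∈p∩q⁻ X Y m | x∈p∪q⁻ _ _ z
  ... | _   , a∈Y | inj₂ a∈XT = avoids sY a∈Y (proj₂ (x∈p∩q⁻ X T a∈XT))
  ... | a∈X , a∈Y | inj₁ z' with x∈p∪q⁻ _ _ z'
  ... | inj₁ a∈YS = avoids sX a∈X (proj₂ (x∈p∩q⁻ Y S a∈YS))
  ... | inj₂ a∈ST = avoids sX a∈X (proj₁ (x∈p∩q⁻ S T a∈ST))
  exits (corner-shore {S} {T} {X} {Y} sX sY) m e with x∈p∩q⁻ X Y m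
  ... | a∈X , a∈Y with exits sX a∈X e | exits sY a∈Y e
  ... | inj₁ w∈X | inj₁ w∈Y = inj₁ (x∈p∩q⁺ (w∈X , w∈Y))
  ... | inj₁ w∈X | inj₂ w∈T = inj₂ (x∈p∪q⁺ (inj₂ (x∈p∩q⁺ (w∈X , w∈T))))
  ... | inj₂ w∈S | inj₁ w∈Y = inj₂ (x∈p∪q⁺ (inj₁ (x∈p∪q⁺ (inj₁ (x∈p∩q⁺ (w∈Y , w∈S))))))
  ... | inj₂ w∈S | inj₂ w∈T = inj₂ (x∈p∪q⁺ (inj₁ (x∈p∪q⁺ (inj₂ (x∈p∩q⁺ (w∈S , w∈T))))))

  corner-separates : ∀ {S T X Y x y} → Shore S X → Shore T Y
    → x ∈ X → x ∈ Y → y ∉ Y → y ∉ T → Separator G (corner S T X Y)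
  corner-separates {S} {T} {X} {Y} {x} {y} sX sY x∈X x∈Y y∉Y y∉T =
    shore-separates (corner-shore sX sY) (x∈p∩q⁺ (x∈X , x∈Y)) (λ m → y∉Y (proj₂ (x∈p∩q⁻ X Y m))) y∉corner
    where
    y∉corner : y ∉ corner S T X Y
    y∉corner z with x∈p∪q⁻ _ _ z
    ... | inj₂ y∈XT = y∉T (proj₂ (x∈p∩q⁻ X T y∈XT))
    ... | inj₁ z' with x∈p∪q⁻ _ _ z'
    ... | inj₁ y∈YS = y∉Y (proj₁ (x∈p∩q⁻ Y S y∈YS))
    ... | inj₂ y∈ST = y∉T (proj₂ (x∈p∩q⁻ S T y∈ST))

  corner-size : ∀ S T X Y → ∣ corner S T X Y ∣ ≤ ∣ Y ∩ S ∣ + ∣ S ∩ T ∣ + ∣ X ∩ T ∣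
  corner-size S T X Y =
    ≤-trans (∣∪∣≤+ ((Y ∩ S) ∪ (S ∩ T)) (X ∩ T)) (+-monoˡ-≤ ∣ X ∩ T ∣ (∣∪∣≤+ (Y ∩ S) (S ∩ T)))

  -- Part (3), "if": when no minimum separator meets K, any (S',K') ≤ (S,K) in P(G)
  -- has K ⊆ K' (K lies in one component of G - S'), and then S ⊆ S' because every
  -- vertex of S has a neighbour in K; equality follows by minimality of |S'|.
  unhit⇒end : ∀ {S K} → InP G S K → ¬ (∃ λ S' → MinSeparator G S' × Nonempty (S' ∩ K))
    → InP₀ G S K
  unhit⇒end {S} {K} inP@(S-min , cK) unhit = inP , minimal
    where
    open ComponentFacts cK using (neighbour-in; avoids-S)
    minimal : ∀ S' K' → InP G S' K' → K' ⊆ K → S' ≡ S × K' ≡ K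
    minimal S' K' (S'-min , cK') K'⊆K = ≡-sym (⊆-∣≥∣⇒≡ S⊆S' (proj₂ S'-min S (proj₁ S-min))) , K'≡K
      where
      K∩S'=∅ : Disjoint K S'
      K∩S'=∅ v∈K v∈S' = unhit (S' , S'-min , _ , x∈p∩q⁺ (v∈S' , v∈K))
      K⊆K' : K ⊆ K'
      K⊆K' = component-⊆ cK cK' K∩S'=∅ (K'⊆K (proj₂ (proj₁ cK'))) (proj₂ (proj₁ cK'))
      K'≡K : K' ≡ K
      K'≡K = ⊆-antisym K'⊆K K⊆K'
      S⊆S' : S ⊆ S'
      S⊆S' {a} a∈S with a ∈? S'
      ... | yes a∈S' = a∈S'
      ... | no  a∉S' with neighbour-in S-min a∈S
      ... | w , w∈K , e =
        ⊥-elim (avoids-S (K'⊆K (ComponentFacts.closed cK' (K⊆K' w∈K) (edge-sym e) a∉S')) a∈S)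

  module _ (k : ℕ) (not-connected : ¬ IsConnectedK G (suc k))
           (min-degree : ∀ v → 3 * k ≤ 2 * degree G v + 1) where

    -- If a minimum separator had more than k vertices, G would be (k+1)-connected:
    -- G - X is connected whenever |X| ≤ k, and S, a vertex of K and a vertex
    -- beyond K ∪ S give more than k + 1 vertices.
    min-separator≤k : ∀ {S K} → MinSeparator G S → Component G S K → ∣ S ∣ ≤ k
    min-separator≤k {S} {K} (separates , minimum) cK with ∣ S ∣ ≤? k
    ... | yes small = small
    ... | no  large = ⊥-elim (not-connected (more-vertices , robust))
      where
      open ComponentFacts cK using (avoids-S; remainder-nonempty; remainder⁻)
      k<∣S∣ : k < ∣ S ∣
      k<∣S∣ = ≰⇒> large
      more-vertices : suc k < n
      more-vertices with proj₁ cK | remainder-nonempty separates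
      ... | x , x∈K | y , y∈R =
        subst (suc k <_) (∣⊤∣≡n n) (≤-<-trans k<∣S∣ (<-trans (p⊂q⇒∣p∣<∣q∣ S⊂S∪K) (p⊂q⇒∣p∣<∣q∣ S∪K⊂⊤)))
        where
        S⊂S∪K : S ⊂ S ∪ K
        S⊂S∪K = (λ a → x∈p∪q⁺ (inj₁ a)) , x , x∈p∪q⁺ (inj₂ x∈K) , avoids-S x∈K
        S∪K⊂⊤ : S ∪ K ⊂ ⊤
        S∪K⊂⊤ = ⊆⊤ , y , ∈⊤ , λ m → [ proj₂ (remainder⁻ y∈R) , proj₁ (remainder⁻ y∈R) ] (x∈p∪q⁻ S K m)
      robust : ∀ X → ∣ X ∣ < suc k → Connected G (∁ X)
      robust X (s≤s ∣X∣≤k) u v u∉X v∉X with reach? (∁ X) u v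
      ... | yes r = r
      ... | no ¬r = ⊥-elim (<⇒≱ (<-≤-trans k<∣S∣ (minimum X λ conn → ¬r (conn u v u∉X v∉X))) ∣X∣≤k)

    shore-heavy : ∀ {Z X W v} → Shore Z X → v ∈ X → ∣ Z ∣ ≤ k → X ⊆ W → ∣ Z ∣ < 2 * ∣ X ∩ W ∣
    shore-heavy {Z} {X} {W} {v} sh v∈X small X⊆W =
      <-≤-trans (degree-arithmetic (∣ Z ∣) k (degree G v) (∣ X ∣) small (min-degree v) (degree-bound sh v∈X))
                (*-monoʳ-≤ 2 (p⊆q⇒∣p∣≤∣q∣ λ a → x∈p∩q⁺ (a , X⊆W a)))

    module Crossing {S K T : Subset n} {t : Fin n} (end : InP₀ G S K)
                    (T-min : MinSeparator G T) (t∈T : t ∈ T) (t∈K : t ∈ K) where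

      S-min : MinSeparator G S
      S-min = proj₁ (proj₁ end)

      cK : Component G S K
      cK = proj₂ (proj₁ end)

      module KF = ComponentFacts cK

      κ : ℕ
      κ = ∣ S ∣

      ∣T∣≡κ : ∣ T ∣ ≡ κ
      ∣T∣≡κ = ≤-antisym (proj₂ T-min S (proj₁ S-min)) (proj₂ S-min T (proj₁ T-min))

      κ≤k : κ ≤ k
      κ≤k = min-separator≤k S-min cK

      ∣T∣≤k : ∣ T ∣ ≤ k
      ∣T∣≤k = subst (_≤ k) (≡-sym ∣T∣≡κ) κ≤k

      l₀ : Fin n
      l₀ = proj₁ (separator-misses (proj₁ T-min))

      l₀∉T : l₀ ∉ T
      l₀∉T = proj₂ (separator-misses (proj₁ T-min))

      L : Subset n
      L = component T l₀

      cL : Component G T L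
      cL = component-is l₀∉T

      module LF = ComponentFacts cL

      K̄ L̄ : Subset n
      K̄ = KF.remainder
      L̄ = LF.remainder

      k₀∈K : proj₁ (proj₁ cK) ∈ K
      k₀∈K = proj₂ (proj₁ cK)

      k̄∈K̄ : proj₁ (KF.remainder-nonempty (proj₁ S-min)) ∈ K̄
      k̄∈K̄ = proj₂ (KF.remainder-nonempty (proj₁ S-min))

      l₀∈L : l₀ ∈ L
      l₀∈L = component-∋ T l₀

      l̄ : Fin n
      l̄ = proj₁ (LF.remainder-nonempty (proj₁ T-min))

      l̄∈L̄ : l̄ ∈ L̄
      l̄∈L̄ = proj₂ (LF.remainder-nonempty (proj₁ T-min))

      p q r s c : ℕ
      p = ∣ K ∩ T ∣
      q = ∣ K̄ ∩ T ∣
      r = ∣ L ∩ S ∣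
      s = ∣ L̄ ∩ S ∣
      c = ∣ S ∩ T ∣

      S-split : r + c + s ≤ κ
      S-split = subst (λ X → r + ∣ X ∣ + s ≤ κ) (∩-comm T S) (LF.three-parts S)

      T-split : p + c + q ≤ κ
      T-split = subst (p + c + q ≤_) ∣T∣≡κ (KF.three-parts T)

      corner-bound : ∀ {X Y x y} → Shore S X → Shore T Y → x ∈ X → x ∈ Y → y ∉ Y → y ∉ T
        → κ ≤ ∣ Y ∩ S ∣ + c + ∣ X ∩ T ∣
      corner-bound {X} {Y} sX sY x∈X x∈Y y∉Y y∉T =
        ≤-trans (proj₂ S-min _ (corner-separates sX sY x∈X x∈Y y∉Y y∉T)) (corner-size S T X Y)

      -- For corners of K the bound is strict: a corner separator of size κ would be
      -- a minimum separator with a component inside K ∩ Y; by minimality of (S,K)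
      -- that component is K itself, yet it misses t ∈ T.
      K-corner-not-tight : ∀ {Y x y} → Shore T Y → x ∈ K → x ∈ Y → y ∉ Y → y ∉ T
        → ¬ (∣ Y ∩ S ∣ + c + p ≤ κ)
      K-corner-not-tight {Y} {x} sY x∈K x∈Y y∉Y y∉T small = avoids sY t∈Y t∈T
        where
        Z : Subset n
        Z = corner S T K Y
        Z-shore : Shore Z (K ∩ Y)
        Z-shore = corner-shore KF.shore sY
        x∈KY : x ∈ K ∩ Y
        x∈KY = x∈p∩q⁺ (x∈K , x∈Y)
        Z-min : MinSeparator G Z
        Z-min = corner-separates KF.shore sY x∈K x∈Y y∉Y y∉T
              , λ S' sep → ≤-trans (≤-trans (corner-size S T K Y) small) (proj₂ S-min S' sep)
        C⊆KY : component Z x ⊆ K ∩ Y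
        C⊆KY = component-⊆-shore Z-shore x∈KY
        C≡K : component Z x ≡ K
        C≡K = proj₂ (proj₂ end Z _ (Z-min , component-is (avoids Z-shore x∈KY))
                                   (λ m → proj₁ (x∈p∩q⁻ K Y (C⊆KY m))))
        t∈Y : t ∈ Y
        t∈Y = proj₂ (x∈p∩q⁻ K Y (C⊆KY (subst (t ∈_) (≡-sym C≡K) t∈K)))

      K-corner : ∀ {Y y} → Shore T Y → y ∉ Y → y ∉ T → Disjoint K Y ⊎ κ < ∣ Y ∩ S ∣ + c + p
      K-corner {Y} sY y∉Y y∉T with disjoint? K Y
      ... | inj₁ apart           = inj₁ apart
      ... | inj₂ (_ , x∈K , x∈Y) = inj₂ (≰⇒> (K-corner-not-tight sY x∈K x∈Y y∉Y y∉T))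

      K̄-corner : ∀ {Y y} → Shore T Y → y ∉ Y → y ∉ T → Disjoint K̄ Y ⊎ κ ≤ ∣ Y ∩ S ∣ + c + q
      K̄-corner {Y} sY y∉Y y∉T with disjoint? K̄ Y
      ... | inj₁ apart           = inj₁ apart
      ... | inj₂ (_ , x∈K̄ , x∈Y) = inj₂ (corner-bound KF.remainder-shore sY x∈K̄ x∈Y y∉Y y∉T)

      -- Two empty corners along a side put that side inside the other separator.
      K-heavy : Disjoint K L → Disjoint K L̄ → κ < 2 * p
      K-heavy KL KL̄ = shore-heavy KF.shore k₀∈K κ≤k (covered KL KL̄)

      K̄-heavy : Disjoint K̄ L → Disjoint K̄ L̄ → κ < 2 * q
      K̄-heavy K̄L K̄L̄ = shore-heavy KF.remainder-shore k̄∈K̄ κ≤k (covered K̄L K̄L̄)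

      L-heavy : Disjoint K L → Disjoint K̄ L → κ < 2 * r
      L-heavy KL K̄L = subst (_< 2 * r) ∣T∣≡κ
        (shore-heavy LF.shore l₀∈L ∣T∣≤k (covered (disjoint-sym KL) (disjoint-sym K̄L)))

      L̄-heavy : Disjoint K L̄ → Disjoint K̄ L̄ → κ < 2 * s
      L̄-heavy KL̄ K̄L̄ = subst (_< 2 * s) ∣T∣≡κ
        (shore-heavy LF.remainder-shore l̄∈L̄ ∣T∣≤k (covered (disjoint-sym KL̄) (disjoint-sym K̄L̄)))

      impossible : ⊥
      impossible = crossing-arithmetic κ p q r s c S-split T-split
        (K-corner LF.shore l̄∉L l̄∉T) (K-corner LF.remainder-shore l₀∉L̄ l₀∉T)
        (K̄-corner LF.shore l̄∉L l̄∉T) (K̄-corner LF.remainder-shore l₀∉L̄ l₀∉T)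
        K-heavy K̄-heavy L-heavy L̄-heavy
        where
        l̄∉L : l̄ ∉ L
        l̄∉L = proj₁ (LF.remainder⁻ l̄∈L̄)
        l̄∉T : l̄ ∉ T
        l̄∉T = proj₂ (LF.remainder⁻ l̄∈L̄)
        l₀∉L̄ : l₀ ∉ L̄
        l₀∉L̄ m = proj₁ (LF.remainder⁻ m) l₀∈L

    end-avoids : ∀ {S K T} → InP₀ G S K → MinSeparator G T → Disjoint K T
    end-avoids end T-min t∈K t∈T = Crossing.impossible end T-min t∈T t∈K

    end⇒unhit : ∀ {S K} → InP₀ G S K → ¬ (∃ λ S' → MinSeparator G S' × Nonempty (S' ∩ K))
    end⇒unhit {K = K} end (T , T-min , _ , t∈T∩K) =
      end-avoids end T-min (proj₂ (x∈p∩q⁻ T K t∈T∩K)) (proj₁ (x∈p∩q⁻ T K t∈T∩K))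

    -- Part (1).  K avoids T, so it lies inside L or misses L entirely; in the
    -- latter case S misses L too (each vertex of S has a neighbour in K), and
    -- (K ∪ S) ∩ (L ∪ T) shrinks to S ∩ T.
    end-vs-pair : ∀ S K T L → InP₀ G S K → InP G T L → ¬ (S ≡ T × K ≡ L)
      → K ⊆ L ⊎ (K ∪ S) ∩ (L ∪ T) ≡ S ∩ T
    end-vs-pair S K T L end@((S-min , cK@((x , x∈K) , _)) , _) (T-min , cL) _ with x ∈? L
    ... | yes x∈L = inj₁ (component-⊆ cK cL (end-avoids end T-min) x∈K x∈L)
    ... | no  x∉L = inj₂ (⊆-antisym meet⊆S∩T S∩T⊆meet)
      where
      K∩T=∅ : Disjoint K T
      K∩T=∅ = end-avoids end T-min
      K∩L=∅ : Disjoint K L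
      K∩L=∅ a∈K a∈L = x∉L (component-⊆ cK cL K∩T=∅ a∈K a∈L x∈K)
      S∩L=∅ : Disjoint S L
      S∩L=∅ a∈S a∈L with ComponentFacts.neighbour-in cK S-min a∈S
      ... | w , w∈K , e = K∩L=∅ w∈K (ComponentFacts.closed cL a∈L e (K∩T=∅ w∈K))
      meet⊆S∩T : (K ∪ S) ∩ (L ∪ T) ⊆ S ∩ T
      meet⊆S∩T m with x∈p∩q⁻ (K ∪ S) (L ∪ T) m
      ... | m₁ , m₂ with x∈p∪q⁻ K S m₁ | x∈p∪q⁻ L T m₂
      ... | inj₁ a∈K | inj₁ a∈L = ⊥-elim (K∩L=∅ a∈K a∈L)
      ... | inj₁ a∈K | inj₂ a∈T = ⊥-elim (K∩T=∅ a∈K a∈T)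
      ... | inj₂ a∈S | inj₁ a∈L = ⊥-elim (S∩L=∅ a∈S a∈L)
      ... | inj₂ a∈S | inj₂ a∈T = x∈p∩q⁺ (a∈S , a∈T)
      S∩T⊆meet : S ∩ T ⊆ (K ∪ S) ∩ (L ∪ T)
      S∩T⊆meet m with x∈p∩q⁻ S T m
      ... | a∈S , a∈T = x∈p∩q⁺ (x∈p∪q⁺ (inj₂ a∈S) , x∈p∪q⁺ (inj₂ a∈T))

    -- Part (2): by (1), unless K ⊆ L — which minimality of (T,L) rules out.
    distinct-ends : ∀ S K T L → InP₀ G S K → InP₀ G T L → ¬ (S ≡ T × K ≡ L)
      → (K ∪ S) ∩ (L ∪ T) ≡ S ∩ T
    distinct-ends S K T L end end′ distinct with end-vs-pair S K T L end (proj₁ end′) distinct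
    ... | inj₂ meet = meet
    ... | inj₁ K⊆L  = ⊥-elim (distinct (proj₂ end′ S K (proj₁ end) K⊆L))

-- Lemma 2: parts (1), (2) and (3), for k ≥ 1 (the proof does not need k ≥ 1).
lemma2 : ∀ {n : ℕ} (k : ℕ) (G : Graph n) → 1 ≤ k
    → ¬ IsConnectedK G (suc k)
    → (∀ (v : Fin n) → 3 * k ≤ 2 * degree G v + 1)
    → (∀ (S K S' K' : Subset n) → InP₀ G S K → InP G S' K' → ¬ (S ≡ S' × K ≡ K')
         → K ⊆ K' ⊎ (K ∪ S) ∩ (K' ∪ S') ≡ S ∩ S')
      × (∀ (S K S' K' : Subset n) → InP₀ G S K → InP₀ G S' K' → ¬ (S ≡ S' × K ≡ K')
         → (K ∪ S) ∩ (K' ∪ S') ≡ S ∩ S')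
      × (∀ (S K : Subset n) → InP G S K
         → InP₀ G S K ⇔ (¬ (∃ λ S' → MinSeparator G S' × Nonempty (S' ∩ K))))
lemma2 k G _ not-connected min-degree =
    end-vs-pair G k not-connected min-degree
  , distinct-ends G k not-connected min-degree
  , λ S K inP → mk⇔ (end⇒unhit G k not-connected min-degree) (unhit⇒end G inP)
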